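{- For every set $X$, the states of $X$ in $\mathrm{CPM}(\mathbf{Rel})$ are in bijective correspondence with the graphs whose vertex set is a subset of $X$. Explicitly, a state $R$ corresponds to the graph with vertex set $\{x\in X \mid R(x,x)\}$ and with an edge between $x$ and $x'$ iff $R(x,x')$; conversely a graph corresponds to the relation $R$ with $R(x,x')$ iff there is an edge between $x$ and $x'$.
   Context: $\mathbf{Rel}$ is the category of sets and binary relations, with dagger given by the converse relation. A relation $P: X\to X$ is positive if $P=S^\dagger\circ S$ for some set $Y$ and relation $S: X\to Y$. A state of a set $X$ in $\mathrm{CPM}(\mathbf{Rel})$ is a morphism from the one-element set $\{*\}$ to $X$ in $\mathrm{CPM}(\mathbf{Rel})$; concretely it is a positive relation $R \subseteq X\times X$. In this paper "graph" means a simple undirected labelled graph with a self-loop on every vertex: a set $W$ of vertices (here a subset of $X$) together with a set $E$ of unordered pairs $\{v,w\}$ of vertices (with $v=w$ allowed), such that $\{v\}\in E$ for every $v\in W$. -}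

module Defs where

open import Level using (Level; suc; _⊔_)
open import Data.Product using (Σ; Σ-syntax; _×_; _,_; proj₁; proj₂)
open import Function.Bundles using (_⇔_)

BinRel : ∀ {ℓ} → Set ℓ → Set ℓ → Set (suc ℓ)
BinRel {ℓ} X Y = X → Y → Set ℓ

_† : ∀ {ℓ} {X Y : Set ℓ} → BinRel X Y → BinRel Y X
(S †) y x = S x y

_∘ʳ_ : ∀ {ℓ} {X Y Z : Set ℓ} → BinRel Y Z → BinRel X Y → BinRel X Z
(T ∘ʳ S) x z = Σ _ λ y → S x y × T y z

_≐_ : ∀ {ℓ} {X Y : Set ℓ} → BinRel X Y → BinRel X Y → Set ℓ
R ≐ R' = ∀ x y → R x y ⇔ R' x y

IsPositive : ∀ {ℓ} {X : Set ℓ} → BinRel X X → Set (suc ℓ)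
IsPositive {ℓ} {X} P = Σ[ Y ∈ Set ℓ ] Σ[ S ∈ BinRel X Y ] (P ≐ ((S †) ∘ʳ S))

-- A state of X in CPM(Rel): a positive relation R ⊆ X × X
State : ∀ {ℓ} → Set ℓ → Set (suc ℓ)
State X = Σ[ R ∈ BinRel X X ] IsPositive R

-- A graph with vertex set a subset W of X: simple undirected, with a
-- self-loop on every vertex. Unordered pairs {v,w} are encoded by a
-- symmetric edge relation E; edges only join vertices of W.
record Graph {ℓ} (X : Set ℓ) : Set (suc ℓ) where
  field
    Vtx   : X → Set ℓ
    Edge  : BinRel X X
    sym   : ∀ x y → Edge x y → Edge y x
    edge-vtx : ∀ x y → Edge x y → Vtx x × Vtx y
    loop  : ∀ x → Vtx x → Edge x x
open Graph public

_≅G_ : ∀ {ℓ} {X : Set ℓ} → Graph X → Graph X → Set ℓ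
G ≅G H = (∀ x → Vtx G x ⇔ Vtx H x) × (Edge G ≐ Edge H)

_≅S_ : ∀ {ℓ} {X : Set ℓ} → State X → State X → Set ℓ
s ≅S t = proj₁ s ≐ proj₁ t

module Submission where

-- The proof rests on an intrinsic characterisation of positive relations:
-- a relation R on X is positive (R = S† ∘ S) iff it is symmetric and
-- "diagonally dominated", i.e. R x y implies R x x (and hence R y y).
--  * Every positive relation has both properties: a witness y of
--    (S† ∘ S) x y can be reused in either order, or twice on the same side.
--  * Conversely such a relation E factors through its own set of related
--    pairs: S x (a , b , _) holds iff x is a or x is b. Two points share
--    such a pair exactly when they are equal and on the diagonal of E, or
--    are the two ends of a related pair (up to symmetry).
-- A graph is precisely a symmetric, diagonally dominated edge relation
-- together with its set of vertices, which is forced to be the diagonal.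
-- Hence the translations state ↦ (diagonal, R) and graph ↦ edge relation
-- are mutually inverse, up to pointwise logical equivalence.

open import Defs
open import Data.Product using (Σ; Σ-syntax; _×_; _,_; proj₁; proj₂)
open import Data.Sum using (_⊎_; inj₁; inj₂)
open import Function.Bundles using (_⇔_; mk⇔; Equivalence)
open import Function.Construct.Identity using (⇔-id)
open import Relation.Binary.PropositionalEquality using (_≡_; refl)

module _ {ℓ} {X : Set ℓ} where

  ≐-refl : {Y : Set ℓ} (R : BinRel X Y) → R ≐ R
  ≐-refl R x y = ⇔-id (R x y)

  DiagonallyDominated : BinRel X X → Set ℓ
  DiagonallyDominated R = ∀ x y → R x y → R x x

  Symmetric : BinRel X X → Set ℓ
  Symmetric R = ∀ x y → R x y → R y x

  positive⇒symmetric : {R : BinRel X X} → IsPositive R → Symmetric R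
  positive⇒symmetric (_ , _ , R≐S†S) x y r =
    let (w , sxw , syw) = Equivalence.to (R≐S†S x y) r
    in  Equivalence.from (R≐S†S y x) (w , syw , sxw)

  positive⇒diagonallyDominated : {R : BinRel X X} →
    IsPositive R → DiagonallyDominated R
  positive⇒diagonallyDominated (_ , _ , R≐S†S) x y r =
    let (w , sxw , _) = Equivalence.to (R≐S†S x y) r
    in  Equivalence.from (R≐S†S x x) (w , sxw , sxw)

  -- The converse: a symmetric, diagonally dominated relation E is positive,
  -- factoring through the set of E-related pairs via the incidence relation.
  module Factorisation (E : BinRel X X)
                       (E-sym : Symmetric E)
                       (E-diag : DiagonallyDominated E) where

    RelatedPair : Set ℓ
    RelatedPair = Σ X λ a → Σ X λ b → E a b

    Incident : BinRel X RelatedPair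
    Incident x (a , b , _) = (x ≡ a) ⊎ (x ≡ b)

    commonPair⇒related : ∀ x z → ((Incident †) ∘ʳ Incident) x z → E x z
    commonPair⇒related _ _ ((a , b , e) , inj₁ refl , inj₁ refl) = E-diag a b e
    commonPair⇒related _ _ ((a , b , e) , inj₁ refl , inj₂ refl) = e
    commonPair⇒related _ _ ((a , b , e) , inj₂ refl , inj₁ refl) = E-sym a b e
    commonPair⇒related _ _ ((a , b , e) , inj₂ refl , inj₂ refl) =
      E-diag b a (E-sym a b e)

    factorisation : E ≐ ((Incident †) ∘ʳ Incident)
    factorisation x z =
      mk⇔ (λ e → (x , z , e) , inj₁ refl , inj₂ refl) (commonPair⇒related x z)

  symmetric∧diagonallyDominated⇒positive : {E : BinRel X X} →
    Symmetric E → DiagonallyDominated E → IsPositive E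
  symmetric∧diagonallyDominated⇒positive {E} E-sym E-diag =
    RelatedPair , Incident , factorisation
    where open Factorisation E E-sym E-diag

  stateGraph : State X → Graph X
  stateGraph (R , R-pos) = record
    { Vtx      = λ x → R x x
    ; Edge     = R
    ; sym      = R-sym
    ; edge-vtx = λ x y r → R-diag x y r , R-diag y x (R-sym x y r)
    ; loop     = λ _ r → r
    }
    where
    R-sym : Symmetric R
    R-sym = positive⇒symmetric R-pos
    R-diag : DiagonallyDominated R
    R-diag = positive⇒diagonallyDominated R-pos

  -- The edge relation of a graph is diagonally dominated: an edge forces its
  -- endpoint to be a vertex, and vertices carry a self-loop.
  edge-diagonallyDominated : (G : Graph X) → DiagonallyDominated (Edge G)
  edge-diagonallyDominated G x y e = loop G x (proj₁ (edge-vtx G x y e))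

  graphState : Graph X → State X
  graphState G =
    Edge G , symmetric∧diagonallyDominated⇒positive (sym G) (edge-diagonallyDominated G)

  loop⇔vertex : (G : Graph X) → ∀ x → Edge G x x ⇔ Vtx G x
  loop⇔vertex G x = mk⇔ (λ e → proj₁ (edge-vtx G x x e)) (loop G x)

proposition3p3 : ∀ {ℓ} (X : Set ℓ) →
    Σ[ toGraph ∈ (State X → Graph X) ] Σ[ toState ∈ (Graph X → State X) ]
    ((∀ (s : State X) →
    (∀ x → Vtx (toGraph s) x ⇔ proj₁ s x x)
    × (Edge (toGraph s) ≐ proj₁ s))
    × (∀ (G : Graph X) → proj₁ (toState G) ≐ Edge G)
    × (∀ (s : State X) → toState (toGraph s) ≅S s)
    × (∀ (G : Graph X) → toGraph (toState G) ≅G G))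
-- Both round trips are identities on the relation; the only non-trivial
-- component is that a graph's vertices are recovered as its self-loops.
proposition3p3 X = stateGraph , graphState ,
  (λ s → (λ x → ⇔-id (proj₁ s x x)) , ≐-refl (proj₁ s)) ,
  (λ G → ≐-refl (Edge G)) ,
  (λ s → ≐-refl (proj₁ s)) ,
  (λ G → loop⇔vertex G , ≐-refl (Edge G))
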